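{- Let $G=(V,E,\Sigma,\Pi)$ be a constraint graph and let $\psi_\mathsf{s},\psi_\mathsf{t}$ be two satisfying labelings of $G$. Then $$\mathrm{val}_G(\psi_\mathsf{s}\leftrightsquigarrow\psi_\mathsf{t})\ \ge\ \max_{S\subset V}\min\left\{\frac{|E[S]|}{|E|},\frac{|E[V\setminus S]|}{|E|}\right\},$$ where $E[S]$ denotes the edge set of the subgraph of $(V,E)$ induced by $S$.
   Context: A constraint graph is a tuple $G=(V,E,\Sigma,\Pi)$ where $(V,E)$ is a finite undirected graph, $\Sigma$ is a finite alphabet, and $\Pi=(\pi_e)_{e\in E}$ with each $\pi_e\subseteq\Sigma^e$ a set of admissible pairs of values for the endpoints of $e$. A labeling is a map $\psi\colon V\to\Sigma$; it satisfies edge $e=(v,w)$ if $(\psi(v),\psi(w))\in\pi_e$, and satisfies $G$ if it satisfies every edge. $\mathrm{val}_G(\psi)$ is the fraction of edges satisfied by $\psi$. A reconfiguration sequence from $\psi_\mathsf{s}$ to $\psi_\mathsf{t}$ is a sequence of labelings starting at $\psi_\mathsf{s}$, ending at $\psi_\mathsf{t}$, with consecutive labelings differing in exactly one vertex; its value is the minimum of $\mathrm{val}_G$ over its labelings. $\mathrm{val}_G(\psi_\mathsf{s}\leftrightsquigarrow\psi_\mathsf{t})$ is the maximum value over all such reconfiguration sequences. -}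

module Defs where

open import Data.Nat using (ℕ; zero; suc; _+_; NonZero)
open import Data.Bool using (Bool; true; false; if_then_else_; _∧_)
open import Data.Fin using (Fin; zero; suc; inject₁; fromℕ)
open import Data.Fin.Subset using (Subset; inside; ∁)
open import Data.Vec using (lookup)
open import Data.Product using (_×_; Σ; ∃; _,_; proj₁; proj₂)
open import Data.Integer using (+_)
open import Data.Rational using (ℚ; _/_; _⊓_; _≤_)
open import Relation.Binary.PropositionalEquality using (_≡_; _≢_; _≗_)

-- A constraint graph with vertex set V = Fin n, edge set E = Fin m (each
-- edge e has endpoints (src e, tgt e)), alphabet Σ = Fin k, and for each
-- edge e a (decidable) constraint π_e ⊆ Σ × Σ given by its characteristic
-- function (ordered relative to the endpoints (src e, tgt e)).
record ConstraintGraph (n m k : ℕ) : Set where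
  field
    src tgt : Fin m → Fin n
    π       : Fin m → Fin k → Fin k → Bool

Labeling : (n k : ℕ) → Set
Labeling n k = Fin n → Fin k

countF : {m : ℕ} → (Fin m → Bool) → ℕ
countF {zero}  p = 0
countF {suc m} p = (if p zero then 1 else 0) + countF (λ i → p (suc i))

module _ {n m k : ℕ} (G : ConstraintGraph n m k) where
  open ConstraintGraph G

  satisfiesEdge : Labeling n k → Fin m → Bool
  satisfiesEdge ψ e = π e (ψ (src e)) (ψ (tgt e))

  Satisfies : Labeling n k → Set
  Satisfies ψ = ∀ e → satisfiesEdge ψ e ≡ true

  val : {{_ : NonZero m}} → Labeling n k → ℚ
  val ψ = (+ countF (satisfiesEdge ψ)) / m

  inducedEdges : Subset n → ℕ
  inducedEdges S = countF (λ e → isIn (src e) ∧ isIn (tgt e))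
    where
      isIn : Fin n → Bool
      isIn v = lookup S v

DifferInExactlyOne : {n k : ℕ} → Labeling n k → Labeling n k → Set
DifferInExactlyOne {n} ψ ψ' =
  Σ (Fin n) λ v → (ψ v ≢ ψ' v) × (∀ w → w ≢ v → ψ w ≡ ψ' w)

minF : {L : ℕ} → (Fin (suc L) → ℚ) → ℚ
minF {zero}  f = f zero
minF {suc L} f = f zero ⊓ minF (λ i → f (suc i))

record ReconfSeq {n k : ℕ} (ψs ψt : Labeling n k) : Set where
  field
    len      : ℕ
    step     : Fin (suc len) → Labeling n k
    start    : step zero ≗ ψs
    finish   : step (fromℕ len) ≗ ψt
    adjacent : (i : Fin len) → DifferInExactlyOne (step (inject₁ i)) (step (suc i))

seqValue : {n m k : ℕ} (G : ConstraintGraph n m k) {{_ : NonZero m}}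
           {ψs ψt : Labeling n k} → ReconfSeq ψs ψt → ℚ
seqValue G σ = minF (λ i → val G (ReconfSeq.step σ i))

-- Move from ψs to ψt in two phases: first relabel the vertices of S to their ψt values one
-- at a time, then the vertices outside S. Throughout the first phase both endpoints of every
-- edge inside V ∖ S still carry their ψs labels, and throughout the second phase both
-- endpoints of every edge inside S carry their ψt labels; as ψs and ψt satisfy G, the value
-- stays at least |E[V ∖ S]|/|E|, resp. |E[S]|/|E|. Relabelings that change nothing are
-- allowed in a walk and dropped when it is turned into a reconfiguration sequence.
module Submission where

open import Defs
open import Data.Nat using (ℕ; NonZero)
open import Data.Fin.Subset using (Subset; ∁)
open import Data.Integer using (+_)
open import Data.Rational using (ℚ; _/_; _⊓_; _≤_)
open import Data.Product using (Σ)

open import Data.Nat as ℕ using (zero; suc)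
open import Data.Nat.Properties as ℕ using (m≤n+m)
open import Data.Integer as ℤ using ()
open import Data.Integer.Properties using (*-monoʳ-≤-nonNeg)
open import Data.Rational using (toℚᵘ)
open import Data.Rational.Properties using (toℚᵘ-fromℚᵘ; toℚᵘ-cancel-≤; p⊓q≤p; p⊓q≤q; ⊓-glb; ≤-trans)
open import Data.Rational.Unnormalised using (mkℚᵘ; *≤*)
open import Data.Rational.Unnormalised.Properties as ℚᵘ using ()
open import Data.Bool using (Bool; true; false; if_then_else_; _∧_; not)
open import Data.Fin using (Fin; zero; suc; _≟_)
open import Data.Vec using (lookup)
open import Data.Vec.Properties using (lookup-map)
open import Data.Vec.Functional using (updateAt)
open import Data.Vec.Functional.Properties using (updateAt-updates; updateAt-minimal; updateAt-id-local)
open import Data.List using (List; []; _∷_; allFin)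
open import Data.List.Membership.Propositional using (_∉_)
open import Data.List.Membership.Propositional.Properties using (∈-allFin)
open import Data.List.Relation.Unary.Any using (here; there)
open import Data.Product using (_×_; _,_)
open import Data.Sum using (_⊎_; inj₁; inj₂)
open import Data.Empty using (⊥-elim)
open import Function using (const)
open import Relation.Nullary using (yes; no)
open import Relation.Binary.PropositionalEquality using (_≡_; _≢_; _≗_; refl; sym; trans; cong₂)

countF-mono : ∀ {m} (p q : Fin m → Bool) → (∀ i → p i ≡ true → q i ≡ true) → countF p ℕ.≤ countF q
countF-mono {zero}  p q p⇒q = ℕ.z≤n
countF-mono {suc m} p q p⇒q
  with p zero in p₀ | countF-mono (λ i → p (suc i)) (λ i → q (suc i)) (λ i → p⇒q (suc i))
... | true  | tail≤ rewrite p⇒q zero p₀ = ℕ.s≤s tail≤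
... | false | tail≤ = ℕ.≤-trans tail≤ (m≤n+m _ (if q zero then 1 else 0))

∧-true⁻ : ∀ {a b} → a ∧ b ≡ true → a ≡ true × b ≡ true
∧-true⁻ {true} {true} refl = refl , refl

/-monoˡ-≤ : ∀ {a b} m .{{_ : NonZero m}} → a ℕ.≤ b → (+ a) / m ≤ (+ b) / m
/-monoˡ-≤ {a} {b} (suc m) a≤b = toℚᵘ-cancel-≤ (begin
  toℚᵘ ((+ a) / suc m)  ≃⟨ toℚᵘ-fromℚᵘ (mkℚᵘ (+ a) m) ⟩
  mkℚᵘ (+ a) m          ≤⟨ *≤* (*-monoʳ-≤-nonNeg (+ suc m) (ℤ.+≤+ a≤b)) ⟩
  mkℚᵘ (+ b) m          ≃⟨ toℚᵘ-fromℚᵘ (mkℚᵘ (+ b) m) ⟨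
  toℚᵘ ((+ b) / suc m)  ∎)
  where open ℚᵘ.≤-Reasoning

minF-glb : ∀ {L} (f : Fin (suc L) → ℚ) {c} → (∀ i → c ≤ f i) → c ≤ minF f
minF-glb {zero}  f c≤f = c≤f zero
minF-glb {suc L} f c≤f = ⊓-glb (c≤f zero) (minF-glb (λ i → f (suc i)) (λ i → c≤f (suc i)))

module _ {n k : ℕ} where

  LazyStep : Labeling n k → Labeling n k → Set
  LazyStep φ χ = φ ≗ χ ⊎ DifferInExactlyOne φ χ

  updateAt-lazyStep : ∀ (φ : Labeling n k) v a → LazyStep φ (updateAt φ v (const a))
  updateAt-lazyStep φ v a with φ v ≟ a
  ... | yes φv≡a = inj₁ λ w → sym (updateAt-id-local v φ (sym φv≡a) w)
  ... | no  φv≢a = inj₂ (v , φv≢φ'v , λ w w≢v → sym (updateAt-minimal w v φ w≢v))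
    where
      φv≢φ'v : φ v ≢ updateAt φ v (const a) v
      φv≢φ'v eq = φv≢a (trans eq (updateAt-updates v φ))

  data Walk (P : Labeling n k → Set) : Labeling n k → Labeling n k → Set where
    halt : ∀ {φ χ}   → P φ → φ ≗ χ → Walk P φ χ
    move : ∀ {φ φ' χ} → P φ → LazyStep φ φ' → Walk P φ' χ → Walk P φ χ

  _++ʷ_ : ∀ {P φ χ ω} → Walk P φ χ → Walk P χ ω → Walk P φ ω
  halt p φ≗χ   ++ʷ w' = move p (inj₁ φ≗χ) w'
  move p s w   ++ʷ w' = move p s (w ++ʷ w')

  DifferInExactlyOne-respʳ : ∀ {φ χ χ' : Labeling n k} →
                             χ ≗ χ' → DifferInExactlyOne φ χ → DifferInExactlyOne φ χ'
  DifferInExactlyOne-respʳ χ≗χ' (v , φv≢χv , agree) =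
    v , (λ eq → φv≢χv (trans eq (sym (χ≗χ' v)))) , λ w w≢v → trans (agree w w≢v) (χ≗χ' w)

  module _ {ψ φ χ : Labeling n k} (σ : ReconfSeq φ χ) where
    open ReconfSeq σ

    ReconfSeq-respˡ : ψ ≗ φ → ReconfSeq ψ χ
    ReconfSeq-respˡ ψ≗φ = record
      { len = len ; step = step ; finish = finish ; adjacent = adjacent
      ; start = λ v → trans (start v) (sym (ψ≗φ v)) }

    consStep : Labeling n k → Fin (suc (suc len)) → Labeling n k
    consStep ψ zero    = ψ
    consStep ψ (suc i) = step i

    ReconfSeq-cons : DifferInExactlyOne ψ φ → ReconfSeq ψ χ
    ReconfSeq-cons ψ~φ = record
      { len = suc len ; step = consStep ψ ; start = λ _ → refl ; finish = finish
      ; adjacent = λ { zero    → DifferInExactlyOne-respʳ (λ v → sym (start v)) ψ~φ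
                     ; (suc i) → adjacent i } }

  Walk⇒ReconfSeq : ∀ {P φ χ} → Walk P φ χ → Σ (ReconfSeq φ χ) λ σ → ∀ i → P (ReconfSeq.step σ i)
  Walk⇒ReconfSeq {φ = φ} (halt p φ≗χ) =
    record { len = 0 ; step = λ _ → φ ; start = λ _ → refl ; finish = φ≗χ ; adjacent = λ () } , λ _ → p
  Walk⇒ReconfSeq (move p (inj₁ φ≗φ') w) with Walk⇒ReconfSeq w
  ... | σ , onσ = ReconfSeq-respˡ σ φ≗φ' , onσ
  Walk⇒ReconfSeq {φ = φ} (move p (inj₂ φ~φ') w) with Walk⇒ReconfSeq w
  ... | σ , onσ = ReconfSeq-cons σ φ~φ' , λ { zero → p ; (suc i) → onσ i }

  AgreeOn : Subset n → Labeling n k → Labeling n k → Set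
  AgreeOn T φ χ = ∀ w → lookup T w ≡ true → φ w ≡ χ w

  module _ (T : Subset n) {χ ψ : Labeling n k} (P : Labeling n k → Set)
           (agree⇒P : ∀ φ → AgreeOn T φ χ → P φ) (ψ≈χ : AgreeOn T ψ χ) where

    walk-along : (vs : List (Fin n)) →
                 ∀ φ → AgreeOn T φ χ → (∀ w → w ∉ vs → φ w ≡ ψ w) → Walk P φ ψ
    walk-along []       φ φ≈χ settled = halt (agree⇒P φ φ≈χ) λ w → settled w λ ()
    walk-along (v ∷ vs) φ φ≈χ settled =
      move (agree⇒P φ φ≈χ) (updateAt-lazyStep φ v (ψ v)) (walk-along vs φ' φ'≈χ settled')
      where
        φ' : Labeling n k
        φ' = updateAt φ v (const (ψ v))

        φ'≈χ : AgreeOn T φ' χ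
        φ'≈χ w w∈T with w ≟ v
        ... | yes refl = trans (updateAt-updates v φ) (ψ≈χ w w∈T)
        ... | no  w≢v  = trans (updateAt-minimal w v φ w≢v) (φ≈χ w w∈T)

        settled' : ∀ w → w ∉ vs → φ' w ≡ ψ w
        settled' w w∉vs with w ≟ v
        ... | yes refl = updateAt-updates v φ
        ... | no  w≢v  = trans (updateAt-minimal w v φ w≢v) (settled w w∉v∷vs)
          where
            w∉v∷vs : w ∉ v ∷ vs
            w∉v∷vs (here w≡v)   = w≢v w≡v
            w∉v∷vs (there w∈vs) = w∉vs w∈vs

    walk-toward : ∀ φ → AgreeOn T φ χ → Walk P φ ψ
    walk-toward φ φ≈χ = walk-along (allFin n) φ φ≈χ λ w w∉ → ⊥-elim (w∉ (∈-allFin w))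

  splice : Subset n → Labeling n k → Labeling n k → Labeling n k
  splice S χ ψ w = if lookup S w then χ w else ψ w

  splice-agree-inside : ∀ S (χ ψ : Labeling n k) → AgreeOn S (splice S χ ψ) χ
  splice-agree-inside S χ ψ w w∈S rewrite w∈S = refl

  splice-agree-outside : ∀ S (χ ψ : Labeling n k) → AgreeOn (∁ S) (splice S χ ψ) ψ
  splice-agree-outside S χ ψ w w∈∁S rewrite lookup-map w not S with lookup S w
  splice-agree-outside S χ ψ w () | true
  splice-agree-outside S χ ψ w _  | false = refl

module _ {n m k : ℕ} (G : ConstraintGraph n m k) where
  open ConstraintGraph G

  inducedEdges≤satisfied : ∀ T {ψ φ} → Satisfies G ψ → AgreeOn T φ ψ →
                           inducedEdges G T ℕ.≤ countF (satisfiesEdge G φ)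
  inducedEdges≤satisfied T {φ = φ} ψ⊨G φ≈ψ = countF-mono _ (satisfiesEdge G φ) inside⇒satisfied
    where
      inside⇒satisfied : ∀ e → lookup T (src e) ∧ lookup T (tgt e) ≡ true → satisfiesEdge G φ e ≡ true
      inside⇒satisfied e e⊆T with ∧-true⁻ e⊆T
      ... | s∈T , t∈T = trans (cong₂ (π e) (φ≈ψ (src e) s∈T) (φ≈ψ (tgt e) t∈T)) (ψ⊨G e)

  inducedEdges≤val : ∀ {{_ : NonZero m}} T {ψ φ} → Satisfies G ψ → AgreeOn T φ ψ →
                     (+ inducedEdges G T) / m ≤ val G φ
  inducedEdges≤val T ψ⊨G φ≈ψ = /-monoˡ-≤ m (inducedEdges≤satisfied T ψ⊨G φ≈ψ)

claim2 : {n m k : ℕ} (G : ConstraintGraph n m k) {{_ : NonZero m}}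
         (ψs ψt : Labeling n k) → Satisfies G ψs → Satisfies G ψt →
         (S : Subset n) →
         Σ (ReconfSeq ψs ψt) λ σ →
           (((+ inducedEdges G S) / m) ⊓ ((+ inducedEdges G (∁ S)) / m)) ≤ seqValue G σ
claim2 {n} {m} {k} G ψs ψt ψs⊨G ψt⊨G S =
  let σ , onσ = Walk⇒ReconfSeq (phase₁ ++ʷ phase₂) in σ , minF-glb _ onσ
  where
    inS outS : ℚ
    inS  = (+ inducedEdges G S) / m
    outS = (+ inducedEdges G (∁ S)) / m

    P : Labeling n k → Set
    P φ = inS ⊓ outS ≤ val G φ

    ψ₁ : Labeling n k
    ψ₁ = splice S ψt ψs

    phase₁ : Walk P ψs ψ₁
    phase₁ = walk-toward (∁ S) P
               (λ φ φ≈ψs → ≤-trans (p⊓q≤q inS outS) (inducedEdges≤val G (∁ S) ψs⊨G φ≈ψs))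
               (splice-agree-outside S ψt ψs) ψs (λ _ _ → refl)

    phase₂ : Walk P ψ₁ ψt
    phase₂ = walk-toward S P
               (λ φ φ≈ψt → ≤-trans (p⊓q≤p inS outS) (inducedEdges≤val G S ψt⊨G φ≈ψt))
               (λ _ _ → refl) ψ₁ (splice-agree-inside S ψt ψs)
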